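{- Let $\mathcal{E}$ be a bundle event structure and $x,y\in\mathcal{C}(\mathcal{E})$ with $x\subseteq y$. Then $(x,\preceq_x,\lambda_x)\trianglelefteq(y,\preceq_y,\lambda_y)$, i.e. $\lambda_y|_x=\lambda_x$ and for all $e,e'\in y$, if $e\preceq_y e'$ and $e'\in x$ then $e\in x$ and $e\preceq_x e'$.
   Context: A bundle event structure (BES) over a set of actions $\Sigma$ is $\mathcal{E}=(E,\#,\mapsto,\lambda,\Phi)$: $E$ a set of events; $\#\subseteq E\times E$ an irreflexive symmetric relation; for $x,y\subseteq E$, $x\#y$ means $e\#f$ for all $e\in x,f\in y$ with $e\neq f$; $\mapsto\subseteq\mathcal{P}(E)\times E$ with $x\mapsto e\Rightarrow x\#x$; $\lambda:E\to\Sigma$ a partial function; $\Phi\subseteq E$ with $\Phi\#\Phi$. Let $\mathrm{cfl}(x)=\{e\in E\mid\exists e'\in x: e\#e'\}$. An event trace is a finite sequence $e_1\cdots e_n$ of events such that for each $i$, $e_i\notin\mathrm{cfl}(\{e_1,\dots,e_{i-1}\})\cup\{e_1,\dots,e_{i-1}\}$ and for each bundle $z\mapsto e_i$ there is $j<i$ with $e_j\in z$. A configuration is the set of events of some event trace; $\mathcal{C}(\mathcal{E})$ denotes the set of configurations. For $x\in\mathcal{C}(\mathcal{E})$, $\lambda_x=\lambda|_x$ and $\preceq_x$ is the intersection, over all event traces $e_1\cdots e_n$ with $\{e_1,\dots,e_n\}=x$, of the reflexive-transitive closures of $e_1\preceq e_2\preceq\cdots\preceq e_n$. For labelled posets, $(x,\preceq_x,\lambda_x)\trianglelefteq(y,\preceq_y,\lambda_y)$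 means $x\subseteq y$, $\lambda_y|_x=\lambda_x$, and $e\preceq_y e'\wedge e'\in x\Rightarrow e\in x\wedge e\preceq_x e'$. -}

module Defs where

open import Data.Nat using (ℕ; suc)
open import Data.Fin as Fin using (Fin; toℕ)
open import Data.List using (List; length; lookup)
open import Data.List.Membership.Propositional using (_∈_)
open import Data.Maybe using (Maybe)
open import Data.Product using (Σ; ∃; ∃-syntax; _×_; _,_)
open import Relation.Nullary using (¬_)
open import Relation.Binary.PropositionalEquality using (_≡_; _≢_)
open import Relation.Binary.Construct.Closure.ReflexiveTransitive using (Star)

Pred : Set → Set₁
Pred E = E → Set

-- The bundle relation ↦ ⊆ P(E) × E is represented as an indexed family of
-- bundles: for each index b : Bundle, (bset b) ↦ (target b).
-- λ is a partial function, represented as E → Maybe Act.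
record BES (Act : Set) : Set₁ where
  field
    E        : Set
    _#_      : E → E → Set
    #-irrefl : ∀ e → ¬ (e # e)
    #-sym    : ∀ e f → e # f → f # e
    Bundle   : Set
    bset     : Bundle → Pred E
    target   : Bundle → E
    bundle-conf : ∀ b e f → bset b e → bset b f → e ≢ f → e # f
    lab      : E → Maybe Act
    Φ        : Pred E
    Φ-conf   : ∀ e f → Φ e → Φ f → e ≢ f → e # f

module _ {Act : Set} (𝓔 : BES Act) where
  open BES 𝓔

  IsTrace : List E → Set
  IsTrace t = ∀ (i : Fin (length t)) →
    (∀ (j : Fin (length t)) → j Fin.< i →
        ¬ (lookup t j # lookup t i) × lookup t j ≢ lookup t i)
    × (∀ (b : Bundle) → target b ≡ lookup t i →
        ∃[ j ] (j Fin.< i × bset b (lookup t j)))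

  EventsOf : List E → Pred E → Set
  EventsOf t X = ∀ e → (X e → e ∈ t) × (e ∈ t → X e)

  IsConfig : Pred E → Set
  IsConfig X = ∃[ t ] (IsTrace t × EventsOf t X)

  Succ : (t : List E) → E → E → Set
  Succ t a b = ∃[ i ] ∃[ j ] (toℕ j ≡ suc (toℕ i) × lookup t i ≡ a × lookup t j ≡ b)

  Prec : Pred E → E → E → Set
  Prec X e e' = ∀ (t : List E) → IsTrace t → EventsOf t X → Star (Succ t) e e'

  record LPoset : Set₁ where
    field
      carrier : Pred E
      order   : E → E → Set
      label   : (e : E) → carrier e → Maybe Act

  lposetOf : Pred E → LPoset
  lposetOf X = record { carrier = X ; order = Prec X ; label = λ e _ → lab e }

  _⊆_ : Pred E → Pred E → Set
  X ⊆ Y = ∀ e → X e → Y e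

  _⊴_ : LPoset → LPoset → Set
  P ⊴ Q =
    (carrier P ⊆ carrier Q)
    × (∀ e (p : carrier P e) (q : carrier Q e) → label Q e q ≡ label P e p)
    × (∀ e e' → carrier Q e → carrier Q e' →
         order Q e e' → carrier P e' → carrier P e × order P e e')
    where open LPoset

-- Let t be a trace of x and s a trace of y.  Appending to t the events of
-- y ∖ x in the order in which they occur in s yields a trace u = t ++ w of y:
-- every bundle of an appended event is met earlier in s, hence either in t or
-- earlier in w.  A chain of immediate successors in u that ends inside the
-- prefix t can never leave it, so e ⪯_y e' with e' ∈ x forces e ∈ t and an
-- immediate-successor chain from e to e' inside t.  As t was arbitrary,
-- e ⪯_x e'.
module Submission where

open import Defs
open import Data.Nat using (ℕ; zero; suc; _+_; _<_; z≤n; s≤s)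
open import Data.Nat.Properties using (<-cmp; <-trans; n<1+n; m≤m+n; <-≤-trans; +-monoʳ-<)
open import Data.Fin as Fin using (Fin; toℕ)
open import Data.Fin.Properties using (toℕ-injective; <⇒≢) renaming (_≟_ to _≟ᶠ_; <-asym to <ᶠ-asym)
open import Data.List using (List; []; _∷_; length; lookup; _++_; map; filter; allFin)
open import Data.List.Membership.Propositional using (_∈_; _∉_; mapWith∈)
open import Data.List.Membership.Propositional.Properties
  using (∈-lookup; ∈-allFin; ∈-map⁺; ∈-map⁻; ∈-++⁺ˡ; ∈-++⁺ʳ; ∈-++⁻; ∈-filter⁺; ∈-filter⁻;
         mapWith∈-id; mapWith∈-cong; map-mapWith∈)
open import Data.List.Relation.Unary.Any using (here; there; index)
import Data.List.Membership.DecPropositional as DecMembership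
open import Data.List.Relation.Unary.Any.Properties using (lookup-index)
import Data.List.Relation.Unary.All as All
open import Data.List.Relation.Unary.AllPairs as AllPairs using (AllPairs; []; _∷_)
import Data.List.Relation.Unary.AllPairs.Properties as AllPairsₚ
open import Data.List.Relation.Unary.Unique.Propositional using (Unique)
import Data.List.Relation.Unary.Unique.Propositional.Properties as Uniqueₚ
open import Data.Product using (∃-syntax; _×_; _,_; proj₁; proj₂)
open import Data.Sum using (_⊎_; inj₁; inj₂)
open import Data.Empty using (⊥-elim)
open import Function using (_∘_; id)
open import Relation.Nullary using (¬_; yes; no)
open import Relation.Binary.Definitions using (Asymmetric; tri<; tri≈; tri>)
open import Relation.Binary.PropositionalEquality using (_≡_; _≢_; refl; sym; subst; module ≡-Reasoning)
open import Relation.Binary.Construct.Closure.ReflexiveTransitive using (Star; ε; _◅_)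

infix 4 _[_]=_

data _[_]=_ {A : Set} : List A → ℕ → A → Set where
  here  : ∀ {x xs} → (x ∷ xs) [ zero ]= x
  there : ∀ {x y xs n} → xs [ n ]= x → (y ∷ xs) [ suc n ]= x

private variable
  A : Set
  R : A → A → Set
  a b : A
  xs ys : List A
  i j n : ℕ

lookup⇒[]= : (xs : List A) (k : Fin (length xs)) → xs [ toℕ k ]= lookup xs k
lookup⇒[]= (x ∷ xs) Fin.zero    = here
lookup⇒[]= (x ∷ xs) (Fin.suc k) = there (lookup⇒[]= xs k)

[]=⇒lookup : xs [ n ]= a → ∃[ k ] (toℕ k ≡ n × lookup xs k ≡ a)
[]=⇒lookup here = Fin.zero , refl , refl
[]=⇒lookup (there p) with []=⇒lookup p
... | k , refl , refl = Fin.suc k , refl , refl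

[]=-functional : xs [ n ]= a → xs [ n ]= b → a ≡ b
[]=-functional here      here      = refl
[]=-functional (there p) (there q) = []=-functional p q

[]=⇒< : xs [ n ]= a → n < length xs
[]=⇒< here      = s≤s z≤n
[]=⇒< (there p) = s≤s ([]=⇒< p)

∈⇒[]= : a ∈ xs → ∃[ n ] xs [ n ]= a
∈⇒[]= (here refl) = zero , here
∈⇒[]= (there a∈xs) with ∈⇒[]= a∈xs
... | n , p = suc n , there p

[]=⇒∈ : xs [ n ]= a → a ∈ xs
[]=⇒∈ here      = here refl
[]=⇒∈ (there p) = there ([]=⇒∈ p)

[]=-++⁺ˡ : xs [ n ]= a → (xs ++ ys) [ n ]= a
[]=-++⁺ˡ here      = here
[]=-++⁺ˡ (there p) = there ([]=-++⁺ˡ p)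

[]=-++⁺ʳ : ∀ xs → ys [ n ]= a → (xs ++ ys) [ length xs + n ]= a
[]=-++⁺ʳ []       p = p
[]=-++⁺ʳ (x ∷ xs) p = there ([]=-++⁺ʳ xs p)

[]=-++⁻ˡ : ∀ xs → (xs ++ ys) [ n ]= a → n < length xs → xs [ n ]= a
[]=-++⁻ˡ (x ∷ xs) here      _        = here
[]=-++⁻ˡ (x ∷ xs) (there p) (s≤s n<) = there ([]=-++⁻ˡ xs p n<)

[]=-++⁻ : ∀ xs → (xs ++ ys) [ n ]= a →
          xs [ n ]= a ⊎ ∃[ m ] (n ≡ length xs + m × ys [ m ]= a)
[]=-++⁻ []       p         = inj₂ (_ , refl , p)
[]=-++⁻ (x ∷ xs) here      = inj₁ here
[]=-++⁻ (x ∷ xs) (there p) with []=-++⁻ xs p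
... | inj₁ q              = inj₁ (there q)
... | inj₂ (m , refl , q) = inj₂ (m , refl , q)

[]=-map⁺ : ∀ {B : Set} (f : A → B) → xs [ n ]= a → map f xs [ n ]= f a
[]=-map⁺ f here      = here
[]=-map⁺ f (there p) = there ([]=-map⁺ f p)

[]=-map⁻ : ∀ {B : Set} {f : A → B} {c} → map f xs [ n ]= c → ∃[ a ] (xs [ n ]= a × c ≡ f a)
[]=-map⁻ {xs = x ∷ xs} here      = x , here , refl
[]=-map⁻ {xs = x ∷ xs} (there p) with []=-map⁻ p
... | a , q , refl = a , there q , refl

AllPairs⇒[]= : AllPairs R xs → xs [ i ]= a → xs [ j ]= b → i < j → R a b
AllPairs⇒[]= (Ra ∷ _)    here      (there q) _         = All.lookup Ra ([]=⇒∈ q)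
AllPairs⇒[]= (_ ∷ pairs) (there p) (there q) (s≤s i<j) = AllPairs⇒[]= pairs p q i<j

[]=⇒AllPairs : (∀ {i j a b} → i < j → xs [ i ]= a → xs [ j ]= b → R a b) → AllPairs R xs
[]=⇒AllPairs {xs = []}     _       = []
[]=⇒AllPairs {xs = x ∷ xs} related =
  All.tabulate (λ y∈xs → related (s≤s z≤n) here (there (proj₂ (∈⇒[]= y∈xs))))
  ∷ []=⇒AllPairs (λ i<j p q → related (s≤s i<j) (there p) (there q))

AllPairs⇒[]=-monotone : Asymmetric R → AllPairs R xs →
                        xs [ i ]= a → xs [ j ]= b → R a b → i < j
AllPairs⇒[]=-monotone {R = R} {i = i} {a = a} {j = j} asym pairs p q Rab with <-cmp i j
... | tri< i<j _ _ = i<j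
... | tri≈ _ refl _ = ⊥-elim (asym Raa Raa)
  where Raa : R a a
        Raa = subst (R a) (sym ([]=-functional p q)) Rab
... | tri> _ _ j<i = ⊥-elim (asym Rab (AllPairs⇒[]= pairs q p j<i))

Unique⇒[]=-injective : Unique xs → xs [ i ]= a → xs [ j ]= a → i ≡ j
Unique⇒[]=-injective {i = i} {j = j} distinct p q with <-cmp i j
... | tri< i<j _ _ = ⊥-elim (AllPairs⇒[]= distinct p q i<j refl)
... | tri≈ _ i≡j _ = i≡j
... | tri> _ _ j<i = ⊥-elim (AllPairs⇒[]= distinct q p j<i refl)

module _ {Act : Set} (𝓔 : BES Act) where
  open BES 𝓔

  BundlesSatisfiedAt : List E → ℕ → E → Set
  BundlesSatisfiedAt l p a =
    ∀ bd → target bd ≡ a → ∃[ q ] ∃[ c ] (q < p × l [ q ]= c × bset bd c)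

  record Trace (l : List E) : Set where
    field
      unique           : Unique l
      conflictFree     : ∀ {a b} → a ∈ l → b ∈ l → ¬ a # b
      bundlesSatisfied : ∀ {p a} → l [ p ]= a → BundlesSatisfiedAt l p a

  open Trace

  IsTrace⇒earlier : ∀ {l : List E} {q p b a} → IsTrace 𝓔 l →
                    l [ q ]= b → l [ p ]= a → q < p → ¬ (b # a) × b ≢ a
  IsTrace⇒earlier isTrace qb pa with []=⇒lookup qb | []=⇒lookup pa
  ... | j , refl , refl | i , refl , refl = proj₁ (isTrace i) j

  IsTrace⇒Trace : ∀ {l : List E} → IsTrace 𝓔 l → Trace l
  IsTrace⇒Trace {l} isTrace = record
    { unique           = []=⇒AllPairs (λ q<p qb pa → proj₂ (IsTrace⇒earlier isTrace qb pa q<p))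
    ; conflictFree     = conflict-free
    ; bundlesSatisfied = satisfied
    }
    where
    conflict-free : ∀ {a b} → a ∈ l → b ∈ l → ¬ a # b
    conflict-free {a} a∈l b∈l with ∈⇒[]= a∈l | ∈⇒[]= b∈l
    ... | p , pa | q , qb with <-cmp p q
    ... | tri< p<q _ _ = proj₁ (IsTrace⇒earlier isTrace pa qb p<q)
    ... | tri≈ _ refl _ = subst (λ b → ¬ a # b) ([]=-functional pa qb) (#-irrefl a)
    ... | tri> _ _ q<p = proj₁ (IsTrace⇒earlier isTrace qb pa q<p) ∘ #-sym _ _

    satisfied : ∀ {p a} → l [ p ]= a → BundlesSatisfiedAt l p a
    satisfied pa bd target≡a with []=⇒lookup pa
    ... | i , refl , refl with proj₂ (isTrace i) bd target≡a
    ... | j , j<i , c∈bd = toℕ j , lookup l j , j<i , lookup⇒[]= l j , c∈bd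

  Trace⇒IsTrace : ∀ {l : List E} → Trace l → IsTrace 𝓔 l
  Trace⇒IsTrace {l} trace i = before , satisfied
    where
    before : ∀ j → j Fin.< i → ¬ (lookup l j # lookup l i) × lookup l j ≢ lookup l i
    before j j<i = conflictFree trace (∈-lookup j) (∈-lookup i)
                 , AllPairs⇒[]= (unique trace) (lookup⇒[]= l j) (lookup⇒[]= l i) j<i

    satisfied : ∀ bd → target bd ≡ lookup l i → ∃[ j ] (j Fin.< i × bset bd (lookup l j))
    satisfied bd target≡ with bundlesSatisfied trace (lookup⇒[]= l i) bd target≡
    ... | q , c , q<i , qc , c∈bd with []=⇒lookup qc
    ... | j , refl , refl = j , q<i , c∈bd

  Succ⇒[]= : ∀ {l : List E} {a b} → Succ 𝓔 l a b → ∃[ m ] (l [ m ]= a × l [ suc m ]= b)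
  Succ⇒[]= {l} (i , j , j≡1+i , refl , refl) =
    toℕ i , lookup⇒[]= l i , subst (λ n → l [ n ]= lookup l j) j≡1+i (lookup⇒[]= l j)

  []=⇒Succ : ∀ {l : List E} {m a b} → l [ m ]= a → l [ suc m ]= b → Succ 𝓔 l a b
  []=⇒Succ p q with []=⇒lookup p | []=⇒lookup q
  ... | i , refl , refl | j , j≡1+i , refl = i , j , j≡1+i , refl , refl

  -- Uniqueness pins the predecessor of a prefix element to the position just before it.
  Succ*-++⇒Succ* : ∀ t {w a b} → Unique (t ++ w) →
                   Star (Succ 𝓔 (t ++ w)) a b → b ∈ t → a ∈ t × Star (Succ 𝓔 t) a b
  Succ*-++⇒Succ* t distinct ε b∈t = b∈t , ε
  Succ*-++⇒Succ* t distinct (step ◅ steps) b∈t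
    with Succ*-++⇒Succ* t distinct steps b∈t | Succ⇒[]= step
  ... | a′∈t , chain | m , ua , ua′ with ∈⇒[]= a′∈t
  ... | q , ta′ with Unique⇒[]=-injective distinct ([]=-++⁺ˡ ta′) ua′
  ... | refl = []=⇒∈ ta , []=⇒Succ ta ta′ ◅ chain
    where ta = []=-++⁻ˡ t ua (<-trans (n<1+n m) ([]=⇒< ta′))

  module _ {s t : List E} (traceˢ : Trace s) (traceᵗ : Trace t)
           (t⊆s : ∀ {e} → e ∈ t → e ∈ s) where

    σ : Fin (length s) → E
    σ = lookup s

    lookup-injective : ∀ {k k′} → σ k ≡ σ k′ → k ≡ k′
    lookup-injective {k} {k′} σk≡σk′ = toℕ-injective
      (Unique⇒[]=-injective (unique traceˢ) (lookup⇒[]= s k)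
        (subst (s [ toℕ k′ ]=_) (sym σk≡σk′) (lookup⇒[]= s k′)))

    module Append (ks : List (Fin (length s))) (ascending : AllPairs Fin._<_ ks)
             (fresh : ∀ {k} → k ∈ ks → σ k ∉ t)
             (complete : ∀ k → σ k ∈ t ⊎ k ∈ ks) where

      ++-missing-⊆ : ∀ {e} → e ∈ t ++ map σ ks → e ∈ s
      ++-missing-⊆ e∈u with ∈-++⁻ t e∈u
      ... | inj₁ e∈t = t⊆s e∈t
      ... | inj₂ e∈w with ∈-map⁻ σ e∈w
      ...   | k , _ , refl = ∈-lookup k

      ++-missing-⊇ : ∀ {e} → e ∈ s → e ∈ t ++ map σ ks
      ++-missing-⊇ e∈s = subst (_∈ t ++ map σ ks) (sym (lookup-index e∈s)) (lookup-∈ (index e∈s))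
        where
        lookup-∈ : ∀ k → σ k ∈ t ++ map σ ks
        lookup-∈ k with complete k
        ... | inj₁ σk∈t = ∈-++⁺ˡ σk∈t
        ... | inj₂ k∈ks = ∈-++⁺ʳ t (∈-map⁺ σ k∈ks)

      ++-missing-trace : Trace (t ++ map σ ks)
      ++-missing-trace = record
        { unique           = Uniqueₚ.++⁺ (unique traceᵗ) unique-missing disjoint
        ; conflictFree     = λ a∈u b∈u → conflictFree traceˢ (++-missing-⊆ a∈u) (++-missing-⊆ b∈u)
        ; bundlesSatisfied = satisfied
        }
        where
        unique-missing : Unique (map σ ks)
        unique-missing = Uniqueₚ.map⁺ lookup-injective (AllPairs.map <⇒≢ ascending)

        disjoint : ∀ {e} → ¬ (e ∈ t × e ∈ map σ ks)
        disjoint (e∈t , e∈w) with ∈-map⁻ σ e∈w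
        ... | k , k∈ks , refl = fresh k∈ks e∈t

        -- A bundle of an appended event is met earlier in s: in t, or earlier among the appended events.
        satisfied : ∀ {p a} → (t ++ map σ ks) [ p ]= a → BundlesSatisfiedAt (t ++ map σ ks) p a
        satisfied pa bd target≡ with []=-++⁻ t pa
        ... | inj₁ ta with bundlesSatisfied traceᵗ ta bd target≡
        ...   | q , c , q<p , qc , c∈bd = q , c , q<p , []=-++⁺ˡ qc , c∈bd
        satisfied pa bd target≡ | inj₂ (r , refl , wa) with []=-map⁻ wa
        ... | k , rk , refl with bundlesSatisfied traceˢ (lookup⇒[]= s k) bd target≡
        ... | q , c , q<k , qc , c∈bd with []=⇒lookup qc
        ... | j , refl , refl with complete j
        ... | inj₁ σj∈t =
          let q′ , tq′ = ∈⇒[]= σj∈t in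
          q′ , σ j , <-≤-trans ([]=⇒< tq′) (m≤m+n (length t) r) , []=-++⁺ˡ tq′ , c∈bd
        ... | inj₂ j∈ks =
          let r′ , r′j = ∈⇒[]= j∈ks in
          length t + r′ , σ j ,
          +-monoʳ-< (length t) (AllPairs⇒[]=-monotone <ᶠ-asym ascending r′j rk q<k) ,
          []=-++⁺ʳ t ([]=-map⁺ σ r′j) , c∈bd

    private
      positions : List (Fin (length s))
      positions = mapWith∈ t (λ e∈t → index (t⊆s e∈t))

      t≡map-positions : t ≡ map σ positions
      t≡map-positions = begin
        t                                          ≡⟨ mapWith∈-id t ⟨
        mapWith∈ t (λ {e} _ → e)                   ≡⟨ mapWith∈-cong t _ _ (λ e∈t → lookup-index (t⊆s e∈t)) ⟩
        mapWith∈ t (λ e∈t → σ (index (t⊆s e∈t))) ≡⟨ map-mapWith∈ t _ σ ⟨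
        map σ positions                            ∎
        where open ≡-Reasoning

      σ∈t⇒∈positions : ∀ {k} → σ k ∈ t → k ∈ positions
      σ∈t⇒∈positions {k} σk∈t with ∈-map⁻ σ (subst (σ k ∈_) t≡map-positions σk∈t)
      ... | k′ , k′∈ , σk≡σk′ = subst (_∈ positions) (sym (lookup-injective σk≡σk′)) k′∈

      open DecMembership (_≟ᶠ_ {length s}) using (_∈?_; _∉?_)

      -- Equality of events is not decidable, so the missing events are found through their indices in s.
      missing : List (Fin (length s))
      missing = filter (_∉? positions) (allFin (length s))

      missing-ascending : AllPairs Fin._<_ missing
      missing-ascending = AllPairsₚ.filter⁺ (_∉? positions) (AllPairsₚ.tabulate⁺-< id)

      missing-fresh : ∀ {k} → k ∈ missing → σ k ∉ t
      missing-fresh k∈ = proj₂ (∈-filter⁻ (_∉? positions) {xs = allFin (length s)} k∈) ∘ σ∈t⇒∈positions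

      missing-complete : ∀ k → σ k ∈ t ⊎ k ∈ missing
      missing-complete k with k ∈? positions
      ... | yes k∈ = inj₁ (subst (σ k ∈_) (sym t≡map-positions) (∈-map⁺ σ k∈))
      ... | no k∉  = inj₂ (∈-filter⁺ (_∉? positions) (∈-allFin k) k∉)

    trace-extension : ∃[ w ] (Trace (t ++ w) × (∀ {e} → e ∈ t ++ w → e ∈ s)
                                             × (∀ {e} → e ∈ s → e ∈ t ++ w))
    trace-extension =
      map σ missing , ++-missing-trace , ++-missing-⊆ , ++-missing-⊇
      where open Append missing missing-ascending missing-fresh missing-complete

  Prec⇒Succ* : ∀ {X Y : Pred E} {s t : List E} {e e′} →
               IsTrace 𝓔 s → EventsOf 𝓔 s Y → IsTrace 𝓔 t → EventsOf 𝓔 t X → _⊆_ 𝓔 X Y →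
               Prec 𝓔 Y e e′ → X e′ → e ∈ t × Star (Succ 𝓔 t) e e′
  Prec⇒Succ* {Y = Y} {s} {t} {e′ = e′} isTraceˢ eventsˢ isTraceᵗ eventsᵗ X⊆Y e⪯e′ Xe′ =
    let w , traceᵘ , u⊆s , s⊆u = trace-extension (IsTrace⇒Trace isTraceˢ) (IsTrace⇒Trace isTraceᵗ) t⊆s
        eventsᵘ : EventsOf 𝓔 (t ++ w) Y
        eventsᵘ a = s⊆u ∘ proj₁ (eventsˢ a) , proj₂ (eventsˢ a) ∘ u⊆s
    in Succ*-++⇒Succ* t (unique traceᵘ) (e⪯e′ (t ++ w) (Trace⇒IsTrace traceᵘ) eventsᵘ)
                      (proj₁ (eventsᵗ e′) Xe′)
    where
    t⊆s : ∀ {a} → a ∈ t → a ∈ s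
    t⊆s {a} a∈t = proj₁ (eventsˢ a) (X⊆Y a (proj₂ (eventsᵗ a) a∈t))

proposition1 : ∀ {Act : Set} (𝓔 : BES Act) (X Y : Pred (BES.E 𝓔)) →
    IsConfig 𝓔 X → IsConfig 𝓔 Y → _⊆_ 𝓔 X Y →
    _⊴_ 𝓔 (lposetOf 𝓔 X) (lposetOf 𝓔 Y)
proposition1 𝓔 X Y (t₀ , isTrace₀ , events₀) (s , isTraceˢ , eventsˢ) X⊆Y =
  X⊆Y , (λ _ _ _ → refl) , downward
  where
  downward : ∀ e e′ → Y e → Y e′ → Prec 𝓔 Y e e′ → X e′ → X e × Prec 𝓔 X e e′
  downward e e′ _ _ e⪯e′ Xe′ =
    proj₂ (events₀ e) (proj₁ (restrict isTrace₀ events₀)) ,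
    λ t isTraceᵗ eventsᵗ → proj₂ (restrict isTraceᵗ eventsᵗ)
    where
    restrict : ∀ {t} → IsTrace 𝓔 t → EventsOf 𝓔 t X → e ∈ t × Star (Succ 𝓔 t) e e′
    restrict isTraceᵗ eventsᵗ = Prec⇒Succ* 𝓔 isTraceˢ eventsˢ isTraceᵗ eventsᵗ X⊆Y e⪯e′ Xe′
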